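{- Let $S$ be a numerical semigroup with $\operatorname{F}(S)>2\operatorname{m}(S)$. Then exactly one of the following holds: (1) $S$ is irreducible; (2) there exists $h\in\operatorname{SG}(S)\setminus\{\operatorname{F}(S)\}$ with $h>\operatorname{m}(S)$.
   Context: $\mathbb{N}=\{0,1,2,\ldots\}$. A numerical semigroup is a submonoid $S$ of $(\mathbb{N},+)$ with $\mathbb{N}\setminus S$ finite. $\operatorname{H}(S)=\mathbb{N}\setminus S$; $\operatorname{F}(S)=\max\operatorname{H}(S)$ (Frobenius number); $\operatorname{m}(S)=\min(S\setminus\{0\})$ (multiplicity). The set of special gaps is $\operatorname{SG}(S)=\{h\in\operatorname{H}(S)\mid 2h\in S \text{ and } h+s\in S \text{ for all } s\in S\setminus\{0\}\}$. $S$ is irreducible if it cannot be written as the intersection of two numerical semigroups properly containing $S$. -}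

module Defs where

open import Level using (_⊔_)
open import Data.Nat using (ℕ; _+_; _*_; _≤_; _<_)
open import Data.Product using (Σ; ∃; ∃-syntax; _×_; _,_)
open import Data.Sum using (_⊎_)
open import Relation.Nullary using (¬_; Dec)
open import Relation.Binary.PropositionalEquality using (_≡_; _≢_)

-- Finite complement is expressed as "every n ≥ N lies in S" for some N.
-- Membership is required to be decidable (automatic classically, since the
-- complement is finite; needed for constructive reasoning).
record NumericalSemigroup : Set₁ where
  field
    _∈S : ℕ → Set
    ∈S? : (n : ℕ) → Dec (n ∈S)
    zero∈ : 0 ∈S
    +-closed : ∀ {a b} → a ∈S → b ∈S → (a + b) ∈S
    cofinite : ∃[ N ] (∀ n → N ≤ n → n ∈S)
open NumericalSemigroup public

Gap : NumericalSemigroup → ℕ → Set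
Gap S h = ¬ (_∈S S h)

IsFrobenius : NumericalSemigroup → ℕ → Set
IsFrobenius S f = Gap S f × (∀ h → Gap S h → h ≤ f)

IsMultiplicity : NumericalSemigroup → ℕ → Set
IsMultiplicity S m = _∈S S m × m ≢ 0 × (∀ s → _∈S S s → s ≢ 0 → m ≤ s)

IsSpecialGap : NumericalSemigroup → ℕ → Set
IsSpecialGap S h =
  Gap S h × _∈S S (2 * h) × (∀ s → _∈S S s → s ≢ 0 → _∈S S (h + s))

_⊂_ : NumericalSemigroup → NumericalSemigroup → Set
S ⊂ T = (∀ n → _∈S S n → _∈S T n) × (∃[ n ] (_∈S T n × ¬ (_∈S S n)))

IsIntersection : NumericalSemigroup → NumericalSemigroup → NumericalSemigroup → Set
IsIntersection S T₁ T₂ =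
  ∀ n → (_∈S S n → _∈S T₁ n × _∈S T₂ n) × (_∈S T₁ n × _∈S T₂ n → _∈S S n)

Irreducible : NumericalSemigroup → Set₁
Irreducible S =
  ¬ (Σ NumericalSemigroup λ T₁ → Σ NumericalSemigroup λ T₂ →
       S ⊂ T₁ × S ⊂ T₂ × IsIntersection S T₁ T₂)

ExactlyOne : ∀ {a b} → Set a → Set b → Set (a ⊔ b)
ExactlyOne A B = (A ⊎ B) × ¬ (A × B)

{-# OPTIONS --safe #-}
-- S is irreducible exactly when F(S) is its only special gap: a special gap h ≠ F(S)
-- splits S as (S ∪ {h}) ∩ (S ∪ {F(S)}), and conversely the largest element of T \ S is
-- a special gap of S for every T ⊋ S. When F(S) > 2 m(S), a special gap h < m(S) is
-- reflected to the special gap F(S) − h > m(S).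
module Submission where

open import Defs
open import Data.Nat using (ℕ; zero; suc; _+_; _*_; _∸_; _≤_; _<_; _≟_; _<?_)
open import Data.Nat.Properties
open import Data.Product using (∃; ∃-syntax; _×_; _,_; proj₁; proj₂; map₂)
open import Function using (_∘′_)
open import Data.Sum using (_⊎_; inj₁; inj₂)
open import Relation.Nullary using (¬_; yes; no; contradiction)
open import Relation.Nullary.Decidable using (map′; _×-dec_; _⊎-dec_; _→-dec_; ¬?)
open import Relation.Unary using (Decidable)
open import Relation.Binary.PropositionalEquality
  using (_≡_; _≢_; refl; sym; subst; cong)

bounded⇒greatest : {P : ℕ → Set} → Decidable P → ∀ b → (∀ {k} → P k → k ≤ b) →
                   ∃ P → ∃[ y ] P y × (∀ {k} → P k → k ≤ y)
bounded⇒greatest {P} P? zero    bounded (k , Pk) =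
  0 , subst P (n≤0⇒n≡0 (bounded Pk)) Pk , bounded
bounded⇒greatest {P} P? (suc b) bounded witness with P? (suc b)
... | yes Pb = suc b , Pb , bounded
... | no ¬Pb = bounded⇒greatest P? b below witness
  where
  below : ∀ {k} → P k → k ≤ b
  below Pk = ≤-pred (≤∧≢⇒< (bounded Pk) (λ { refl → ¬Pb Pk }))

2*n≡n+n : ∀ n → 2 * n ≡ n + n
2*n≡n+n n = cong (n +_) (+-identityʳ n)

infix 4 _∈_ _∉_

_∈_ : ℕ → NumericalSemigroup → Set
n ∈ S = _∈S S n

_∉_ : ℕ → NumericalSemigroup → Set
n ∉ S = Gap S n

private
  variable
    f m h h′ : ℕ

module _ (S : NumericalSemigroup) where

  gap⇒≢0 : h ∉ S → h ≢ 0
  gap⇒≢0 h∉S refl = h∉S (zero∈ S)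

  >frobenius⇒∈ : IsFrobenius S f → ∀ {n} → f < n → n ∈ S
  >frobenius⇒∈ (_ , maximal) {n} f<n with ∈S? S n
  ... | yes n∈S = n∈S
  ... | no  n∉S = contradiction (maximal n n∉S) (<⇒≱ f<n)

  frobenius-special : IsFrobenius S f → IsSpecialGap S f
  frobenius-special {f} F@(f∉S , _) =
    f∉S ,
    subst (_∈ S) (sym (2*n≡n+n f)) (>frobenius⇒∈ F (m<m+n f (n≢0⇒n>0 (gap⇒≢0 f∉S)))) ,
    λ _ _ s≢0 → >frobenius⇒∈ F (m<m+n f (n≢0⇒n>0 s≢0))

  -- For s ≥ N the translate h + s ≥ N lies in S, so only s < N need checking.
  special-gap? : Decidable (IsSpecialGap S)
  special-gap? h with cofinite S
  ... | N , ≥N⇒∈ =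
    map′ (map₂ (map₂ extend)) (map₂ (map₂ restrict))
         (¬? (∈S? S h) ×-dec ∈S? S (2 * h) ×-dec allUpTo? translate? N)
    where
    translate? : Decidable (λ s → s ∈ S → s ≢ 0 → h + s ∈ S)
    translate? s = ∈S? S s →-dec (¬? (s ≟ 0) →-dec ∈S? S (h + s))

    restrict : (∀ s → s ∈ S → s ≢ 0 → h + s ∈ S) →
               ∀ {s} → s < N → s ∈ S → s ≢ 0 → h + s ∈ S
    restrict h+S⊆S {s} _ = h+S⊆S s

    extend : (∀ {s} → s < N → s ∈ S → s ≢ 0 → h + s ∈ S) →
             ∀ s → s ∈ S → s ≢ 0 → h + s ∈ S
    extend below s with s <? N
    ... | yes s<N = below s<N
    ... | no  s≮N = λ _ _ → ≥N⇒∈ (h + s) (≤-trans (≮⇒≥ s≮N) (m≤n+m s h))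

  adjoin : IsSpecialGap S h → NumericalSemigroup
  adjoin {h} (_ , 2h∈S , h+S⊆S) = record
    { _∈S      = λ n → n ∈ S ⊎ n ≡ h
    ; ∈S?      = λ n → ∈S? S n ⊎-dec (n ≟ h)
    ; zero∈    = inj₁ (zero∈ S)
    ; +-closed = closed
    ; cofinite = let N , ≥N⇒∈ = cofinite S in N , λ n N≤n → inj₁ (≥N⇒∈ n N≤n)
    }
    where
    closed : ∀ {a b} → a ∈ S ⊎ a ≡ h → b ∈ S ⊎ b ≡ h → a + b ∈ S ⊎ a + b ≡ h
    closed (inj₁ a∈S) (inj₁ b∈S) = inj₁ (+-closed S a∈S b∈S)
    closed {a} (inj₁ a∈S) (inj₂ refl) with a ≟ 0
    ... | yes refl = inj₂ refl
    ... | no  a≢0  = inj₁ (subst (_∈ S) (+-comm h a) (h+S⊆S a a∈S a≢0))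
    closed {b = b} (inj₂ refl) (inj₁ b∈S) with b ≟ 0
    ... | yes refl = inj₂ (+-identityʳ h)
    ... | no  b≢0  = inj₁ (h+S⊆S b b∈S b≢0)
    closed (inj₂ refl) (inj₂ refl) = inj₁ (subst (_∈ S) (2*n≡n+n h) 2h∈S)

  special-gap≢frobenius⇒reducible : IsFrobenius S f → IsSpecialGap S h → h ≢ f →
                                    ¬ Irreducible S
  special-gap≢frobenius⇒reducible {f} F h-special h≢f irreducible =
    irreducible (adjoin h-special , adjoin f-special ,
                 ((λ _ → inj₁) , _ , inj₂ refl , proj₁ h-special) ,
                 ((λ _ → inj₁) , _ , inj₂ refl , proj₁ f-special) ,
                 λ _ → (λ n∈S → inj₁ n∈S , inj₁ n∈S) , meet)
    where
    f-special : IsSpecialGap S f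
    f-special = frobenius-special F

    meet : ∀ {n} → n ∈ adjoin h-special × n ∈ adjoin f-special → n ∈ S
    meet (inj₁ n∈S , _)          = n∈S
    meet (_ , inj₁ n∈S)          = n∈S
    meet (inj₂ refl , inj₂ refl) = contradiction refl h≢f

  greatest-new-element-special : ∀ {T y} → (∀ {n} → n ∈ S → n ∈ T) →
    y ∈ T → y ∉ S → (∀ {k} → k ∈ T × k ∉ S → k ≤ y) → IsSpecialGap S y
  greatest-new-element-special {T} {y} S⊆T y∈T y∉S greatest =
    y∉S ,
    subst (_∈ S) (sym (2*n≡n+n y))
      (beyond (m<m+n y (n≢0⇒n>0 (gap⇒≢0 y∉S))) (+-closed T y∈T y∈T)) ,
    λ s s∈S s≢0 → beyond (m<m+n y (n≢0⇒n>0 s≢0)) (+-closed T y∈T (S⊆T s∈S))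
    where
    beyond : ∀ {n} → y < n → n ∈ T → n ∈ S
    beyond {n} y<n n∈T with ∈S? S n
    ... | yes n∈S = n∈S
    ... | no  n∉S = contradiction (greatest (n∈T , n∉S)) (<⇒≱ y<n)

  ⊂⇒special-gap : ∀ {T} → IsFrobenius S f → S ⊂ T → ∃[ h ] IsSpecialGap S h × h ∈ T
  ⊂⇒special-gap {f} {T} (_ , maximal) (S⊆T , n , n∈T , n∉S)
    with bounded⇒greatest (λ k → ∈S? T k ×-dec ¬? (∈S? S k)) f
                          (λ (_ , k∉S) → maximal _ k∉S) (n , n∈T , n∉S)
  ... | y , (y∈T , y∉S) , greatest =
    y , greatest-new-element-special {T} (λ {n} → S⊆T n) y∈T y∉S greatest , y∈T

  only-frobenius-special⇒irreducible : IsFrobenius S f →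
    (∀ {h} → IsSpecialGap S h → h ≡ f) → Irreducible S
  only-frobenius-special⇒irreducible {f} F@(f∉S , _) only (T₁ , T₂ , S⊂T₁ , S⊂T₂ , S≡T₁∩T₂) =
    f∉S (proj₂ (S≡T₁∩T₂ f) (f∈ {T₁} S⊂T₁ , f∈ {T₂} S⊂T₂))
    where
    f∈ : ∀ {T} → S ⊂ T → f ∈ T
    f∈ {T} S⊂T with ∈S? T f
    ... | yes f∈T = f∈T
    ... | no  f∉T =
      let h , h-special , h∈T = ⊂⇒special-gap {T = T} F S⊂T
      in contradiction (subst (_∈ T) (only h-special) h∈T) f∉T

  -- Every s ∈ S \ {0} exceeds h, so h′ + s > h′ + h = F(S).
  reflect-special-gap : IsFrobenius S f → IsMultiplicity S m → IsSpecialGap S h →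
    h < m → h < h′ → h + h′ ≡ f → IsSpecialGap S h′
  reflect-special-gap {f} {m} {h} {h′} F (_ , _ , minimal) (_ , _ , h+S⊆S) h<m h<h′ h+h′≡f =
    h′∉S ,
    subst (_∈ S) (sym (2*n≡n+n h′)) (beyond (+-monoˡ-< h′ h<h′)) ,
    λ s s∈S s≢0 → beyond (subst (_< h′ + s) (+-comm h′ h)
                    (+-monoʳ-< h′ (<-≤-trans h<m (minimal s s∈S s≢0))))
    where
    beyond : ∀ {n} → h + h′ < n → n ∈ S
    beyond = >frobenius⇒∈ F ∘′ subst (_< _) h+h′≡f

    h′∉S : h′ ∉ S
    h′∉S h′∈S = proj₁ F (subst (_∈ S) h+h′≡f (h+S⊆S h′ h′∈S (m<n⇒n≢0 h<h′)))

  special-gap-above-multiplicity : IsFrobenius S f → IsMultiplicity S m → 2 * m < f →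
    IsSpecialGap S h → h ≢ f → ∃[ h′ ] IsSpecialGap S h′ × h′ ≢ f × m < h′
  special-gap-above-multiplicity {f} {m} {h} F M@(m∈S , _) 2m<f h-special@(h∉S , _) h≢f
    with m <? h
  ... | yes m<h = h , h-special , h≢f , m<h
  ... | no  m≮h =
    f ∸ h , reflect-special-gap F M h-special h<m (<-trans h<m m<f∸h) h+[f∸h]≡f ,
    <⇒≢ (∸-monoʳ-< (n≢0⇒n>0 (gap⇒≢0 h∉S)) h≤f) , m<f∸h
    where
    h<m : h < m
    h<m = ≤∧≢⇒< (≮⇒≥ m≮h) (λ { refl → h∉S m∈S })
    h≤f : h ≤ f
    h≤f = proj₂ F h h∉S
    h+[f∸h]≡f : h + (f ∸ h) ≡ f
    h+[f∸h]≡f = m+[n∸m]≡n h≤f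
    m<f∸h : m < f ∸ h
    m<f∸h = +-cancelˡ-< h m (f ∸ h)
      (subst (h + m <_) (sym h+[f∸h]≡f)
        (<-trans (+-monoˡ-< m h<m) (subst (_< f) (2*n≡n+n m) 2m<f)))

lemma3p5 : (S : NumericalSemigroup) (f m : ℕ) →
    IsFrobenius S f → IsMultiplicity S m → 2 * m < f →
    ExactlyOne (Irreducible S) (∃[ h ] (IsSpecialGap S h × h ≢ f × m < h))
lemma3p5 S f m F M 2m<f = irreducible-or-high-special-gap , not-both
  where
  irreducible-or-high-special-gap
    : Irreducible S ⊎ ∃[ h ] (IsSpecialGap S h × h ≢ f × m < h)
  irreducible-or-high-special-gap with anyUpTo? (special-gap? S) f
  ... | yes (h , h<f , h-special) =
    inj₂ (special-gap-above-multiplicity S F M 2m<f h-special (<⇒≢ h<f))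
  ... | no  none = inj₁ (only-frobenius-special⇒irreducible S F only)
    where
    only : ∀ {h} → IsSpecialGap S h → h ≡ f
    only {h} h-special with m≤n⇒m<n∨m≡n (proj₂ F h (proj₁ h-special))
    ... | inj₁ h<f  = contradiction (h , h<f , h-special) none
    ... | inj₂ h≡f  = h≡f

  not-both : ¬ (Irreducible S × ∃[ h ] (IsSpecialGap S h × h ≢ f × m < h))
  not-both (irreducible , _ , h-special , h≢f , _) =
    special-gap≢frobenius⇒reducible S F h-special h≢f irreducible
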